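{- For $T$-coalgebras $(X_1,\gamma_1)$ and $(X_2,\gamma_2)$, the map $T^\rho_{\gamma_1,\gamma_2}\colon\mathrm{Rel}(X_1,X_2)\to\mathrm{Rel}(X_1,X_2)$ is monotone.
   Context: $P\colon\mathcal C\to\mathcal A$, $S\colon\mathcal A\to\mathcal C$ are contravariant functors forming a dual adjunction (natural bijection $\mathcal C(X,SA)\cong\mathcal A(A,PX)$) with unit $\eta^{\mathcal C}\colon\mathrm{Id}_{\mathcal C}\to SP$. $T\colon\mathcal C\to\mathcal C$ is an endofunctor; a $T$-coalgebra is $(X,\gamma)$ with $\gamma\colon X\to TX$. $(L,\rho)$ is a logic: $L\colon\mathcal A\to\mathcal A$, $\rho\colon LP\to PT$ natural. Standing assumptions: $\mathcal C$ is finitely complete, well-powered, with an $(\mathcal E,\mathrm{Mono})$-factorisation system; $\mathcal A$ has pullbacks or $\mathcal C$ has pushouts. A span $X_1\xleftarrow{\pi_1}B\xrightarrow{\pi_2}X_2$ is jointly mono if $\pi_1h=\pi_1h'$ and $\pi_2h=\pi_2h'$ imply $h=h'$; $\mathrm{Rel}(X_1,X_2)$ is the poset of jointly mono spans up to isomorphism, ordered by $(B,\pi)\le(B',\pi')$ iff some $k\colon B\to B'$ has $\pi_i=\pi_i'k$. The dual span $(\bar B,\bar\pi_1,\bar\pi_2)$ is the pullback in $\mathcal A$ of $PX_1\xrightarrow{P\pi_1}PB\xleftarrow{P\pi_2}PX_2$. Let $\sigma_i=SL\bar\pi_i\circ S\rho_{X_i}\circ\eta^{\mathcal C}_{TX_i}\colon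 TX_i\to SL\bar B$. Then $T^\rho_{\gamma_1,\gamma_2}(B,\pi_1,\pi_2)\in\mathrm{Rel}(X_1,X_2)$ is defined as the pullback in $\mathcal C$ of $X_1\xrightarrow{\sigma_1\circ\gamma_1}SL\bar B\xleftarrow{\sigma_2\circ\gamma_2}X_2$. -}

module Defs where

open import Level using (Level; _⊔_) renaming (suc to lsuc)
open import Relation.Binary using (IsEquivalence)
open import Data.Product using (Σ; Σ-syntax; _,_; proj₁; proj₂; _×_)
open import Data.Sum using (_⊎_)

record Category (o ℓ e : Level) : Set (lsuc (o ⊔ ℓ ⊔ e)) where
  infixr 9 _∘_
  infix 4 _≈_
  field
    Obj : Set o
    _⇒_ : Obj → Obj → Set ℓ
    _≈_ : ∀ {A B} → (A ⇒ B) → (A ⇒ B) → Set e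
    id  : ∀ {A} → A ⇒ A
    _∘_ : ∀ {A B C} → B ⇒ C → A ⇒ B → A ⇒ C
    equiv : ∀ {A B} → IsEquivalence (_≈_ {A} {B})
    ∘-resp-≈ : ∀ {A B C} {f h : B ⇒ C} {g i : A ⇒ B} → f ≈ h → g ≈ i → f ∘ g ≈ h ∘ i
    assoc : ∀ {A B C D} {f : A ⇒ B} {g : B ⇒ C} {h : C ⇒ D} → (h ∘ g) ∘ f ≈ h ∘ (g ∘ f)
    identityˡ : ∀ {A B} {f : A ⇒ B} → id ∘ f ≈ f
    identityʳ : ∀ {A B} {f : A ⇒ B} → f ∘ id ≈ f

  module Eq {A B : Obj} = IsEquivalence (equiv {A} {B})

module _ {o ℓ e : Level} (C : Category o ℓ e) where
  open Category C

  Mono : ∀ {X Y} → X ⇒ Y → Set (o ⊔ ℓ ⊔ e)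
  Mono {X} f = ∀ {Z} (g h : Z ⇒ X) → f ∘ g ≈ f ∘ h → g ≈ h

  IsIso : ∀ {X Y} → X ⇒ Y → Set (ℓ ⊔ e)
  IsIso {X} {Y} f = Σ[ g ∈ Y ⇒ X ] ((g ∘ f ≈ id) × (f ∘ g ≈ id))

  record Pullback {X Y Z : Obj} (f : X ⇒ Z) (g : Y ⇒ Z) : Set (o ⊔ ℓ ⊔ e) where
    field
      P  : Obj
      p₁ : P ⇒ X
      p₂ : P ⇒ Y
      commute : f ∘ p₁ ≈ g ∘ p₂
      universal : ∀ {Q} (q₁ : Q ⇒ X) (q₂ : Q ⇒ Y) → f ∘ q₁ ≈ g ∘ q₂ → Q ⇒ P
      universal₁ : ∀ {Q} {q₁ : Q ⇒ X} {q₂ : Q ⇒ Y} (eq : f ∘ q₁ ≈ g ∘ q₂) →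
                   p₁ ∘ universal q₁ q₂ eq ≈ q₁
      universal₂ : ∀ {Q} {q₁ : Q ⇒ X} {q₂ : Q ⇒ Y} (eq : f ∘ q₁ ≈ g ∘ q₂) →
                   p₂ ∘ universal q₁ q₂ eq ≈ q₂
      unique : ∀ {Q} {q₁ : Q ⇒ X} {q₂ : Q ⇒ Y} (eq : f ∘ q₁ ≈ g ∘ q₂) (u : Q ⇒ P) →
               p₁ ∘ u ≈ q₁ → p₂ ∘ u ≈ q₂ → u ≈ universal q₁ q₂ eq

  record Pushout {X Y Z : Obj} (f : Z ⇒ X) (g : Z ⇒ Y) : Set (o ⊔ ℓ ⊔ e) where
    field
      Q  : Obj
      i₁ : X ⇒ Q
      i₂ : Y ⇒ Q
      commute : i₁ ∘ f ≈ i₂ ∘ g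
      universal : ∀ {R} (r₁ : X ⇒ R) (r₂ : Y ⇒ R) → r₁ ∘ f ≈ r₂ ∘ g → Q ⇒ R
      universal₁ : ∀ {R} {r₁ : X ⇒ R} {r₂ : Y ⇒ R} (eq : r₁ ∘ f ≈ r₂ ∘ g) →
                   universal r₁ r₂ eq ∘ i₁ ≈ r₁
      universal₂ : ∀ {R} {r₁ : X ⇒ R} {r₂ : Y ⇒ R} (eq : r₁ ∘ f ≈ r₂ ∘ g) →
                   universal r₁ r₂ eq ∘ i₂ ≈ r₂
      unique : ∀ {R} {r₁ : X ⇒ R} {r₂ : Y ⇒ R} (eq : r₁ ∘ f ≈ r₂ ∘ g) (u : Q ⇒ R) →
               u ∘ i₁ ≈ r₁ → u ∘ i₂ ≈ r₂ → u ≈ universal r₁ r₂ eq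

  record Terminal : Set (o ⊔ ℓ ⊔ e) where
    field
      ⊤ : Obj
      ! : ∀ {X} → X ⇒ ⊤
      !-unique : ∀ {X} (f : X ⇒ ⊤) → f ≈ !

  HasPullbacks : Set (o ⊔ ℓ ⊔ e)
  HasPullbacks = ∀ {X Y Z} (f : X ⇒ Z) (g : Y ⇒ Z) → Pullback f g

  HasPushouts : Set (o ⊔ ℓ ⊔ e)
  HasPushouts = ∀ {X Y Z} (f : Z ⇒ X) (g : Z ⇒ Y) → Pushout f g

  record FinitelyComplete : Set (o ⊔ ℓ ⊔ e) where
    field
      terminal : Terminal
      pullback : HasPullbacks

  -- well-powered: the subobjects of each object are indexed (up to iso)
  -- by a small type
  WellPowered : Set (lsuc (o ⊔ ℓ) ⊔ e)
  WellPowered = ∀ (X : Obj) →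
    Σ[ I ∈ Set (o ⊔ ℓ) ]
    Σ[ dom ∈ (I → Obj) ]
    Σ[ m ∈ ((i : I) → dom i ⇒ X) ]
      (((i : I) → Mono (m i)) ×
       (∀ {Y} (n : Y ⇒ X) → Mono n →
          Σ[ i ∈ I ] Σ[ h ∈ Y ⇒ dom i ] (IsIso h × (m i ∘ h ≈ n))))

  record EMonoFactorisation : Set (lsuc (o ⊔ ℓ ⊔ e)) where
    field
      E : ∀ {X Y} → X ⇒ Y → Set (o ⊔ ℓ ⊔ e)
      E-resp-≈ : ∀ {X Y} {f g : X ⇒ Y} → f ≈ g → E f → E g
      E-iso : ∀ {X Y} {f : X ⇒ Y} → IsIso f → E f
      E-∘-iso : ∀ {X Y Z} {e′ : X ⇒ Y} {i : Y ⇒ Z} → E e′ → IsIso i → E (i ∘ e′)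
      E-iso-∘ : ∀ {X Y Z} {i : X ⇒ Y} {e′ : Y ⇒ Z} → IsIso i → E e′ → E (e′ ∘ i)
      factor : ∀ {X Y} (f : X ⇒ Y) →
        Σ[ M ∈ Obj ] Σ[ e′ ∈ X ⇒ M ] Σ[ m ∈ M ⇒ Y ] (E e′ × Mono m × (m ∘ e′ ≈ f))
      diagonal : ∀ {A B C D} {e′ : A ⇒ B} {m : C ⇒ D} {u : A ⇒ C} {v : B ⇒ D} →
        E e′ → Mono m → v ∘ e′ ≈ m ∘ u →
        Σ[ d ∈ B ⇒ C ] ((d ∘ e′ ≈ u) × (m ∘ d ≈ v) ×
          (∀ (d′ : B ⇒ C) → d′ ∘ e′ ≈ u → m ∘ d′ ≈ v → d′ ≈ d))

  record Span (X₁ X₂ : Obj) : Set (o ⊔ ℓ) where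
    field
      B  : Obj
      π₁ : B ⇒ X₁
      π₂ : B ⇒ X₂

  JointlyMono : ∀ {X₁ X₂} → Span X₁ X₂ → Set (o ⊔ ℓ ⊔ e)
  JointlyMono s = ∀ {Z} (h h′ : Z ⇒ B) → π₁ ∘ h ≈ π₁ ∘ h′ → π₂ ∘ h ≈ π₂ ∘ h′ → h ≈ h′
    where open Span s

  -- elements of Rel(X₁,X₂) (representatives; the order below is
  -- invariant under isomorphism of spans)
  Rel : Obj → Obj → Set (o ⊔ ℓ ⊔ e)
  Rel X₁ X₂ = Σ (Span X₁ X₂) JointlyMono

  _≤Rel_ : ∀ {X₁ X₂} → Rel X₁ X₂ → Rel X₁ X₂ → Set (ℓ ⊔ e)
  (s , _) ≤Rel (s′ , _) =
    Σ[ k ∈ Span.B s ⇒ Span.B s′ ] ((Span.π₁ s ≈ Span.π₁ s′ ∘ k) × (Span.π₂ s ≈ Span.π₂ s′ ∘ k))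

  pullbackSpan : ∀ {X Y Z} {f : X ⇒ Z} {g : Y ⇒ Z} → Pullback f g → Span X Y
  pullbackSpan pb = record { B = Pullback.P pb ; π₁ = Pullback.p₁ pb ; π₂ = Pullback.p₂ pb }

  pullback-jointlyMono : ∀ {X Y Z} {f : X ⇒ Z} {g : Y ⇒ Z} (pb : Pullback f g) →
                         JointlyMono (pullbackSpan pb)
  pullback-jointlyMono {f = f} {g} pb h h′ e₁ e₂ =
    Eq.trans (unique eq h Eq.refl Eq.refl)
             (Eq.sym (unique eq h′ (Eq.sym e₁) (Eq.sym e₂)))
    where
      open Pullback pb
      eq : f ∘ (p₁ ∘ h) ≈ g ∘ (p₂ ∘ h)
      eq = Eq.trans (Eq.sym assoc) (Eq.trans (∘-resp-≈ commute Eq.refl) assoc)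

  pullbackRel : ∀ {X Y Z} {f : X ⇒ Z} {g : Y ⇒ Z} → Pullback f g → Rel X Y
  pullbackRel pb = pullbackSpan pb , pullback-jointlyMono pb

record Functor {o ℓ e o′ ℓ′ e′ : Level} (C : Category o ℓ e) (D : Category o′ ℓ′ e′)
       : Set (o ⊔ ℓ ⊔ e ⊔ o′ ⊔ ℓ′ ⊔ e′) where
  private
    module C = Category C
    module D = Category D
  field
    F₀ : C.Obj → D.Obj
    F₁ : ∀ {X Y} → X C.⇒ Y → F₀ X D.⇒ F₀ Y
    identity : ∀ {X} → F₁ (C.id {X}) D.≈ D.id
    homomorphism : ∀ {X Y Z} {f : X C.⇒ Y} {g : Y C.⇒ Z} → F₁ (g C.∘ f) D.≈ F₁ g D.∘ F₁ f
    F-resp-≈ : ∀ {X Y} {f g : X C.⇒ Y} → f C.≈ g → F₁ f D.≈ F₁ g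

record ContraFunctor {o ℓ e o′ ℓ′ e′ : Level} (C : Category o ℓ e) (D : Category o′ ℓ′ e′)
       : Set (o ⊔ ℓ ⊔ e ⊔ o′ ⊔ ℓ′ ⊔ e′) where
  private
    module C = Category C
    module D = Category D
  field
    F₀ : C.Obj → D.Obj
    F₁ : ∀ {X Y} → X C.⇒ Y → F₀ Y D.⇒ F₀ X
    identity : ∀ {X} → F₁ (C.id {X}) D.≈ D.id
    homomorphism : ∀ {X Y Z} {f : X C.⇒ Y} {g : Y C.⇒ Z} → F₁ (g C.∘ f) D.≈ F₁ f D.∘ F₁ g
    F-resp-≈ : ∀ {X Y} {f g : X C.⇒ Y} → f C.≈ g → F₁ f D.≈ F₁ g

record DualAdjunction {o ℓ e o′ ℓ′ e′ : Level}
       {C : Category o ℓ e} {A : Category o′ ℓ′ e′}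
       (P : ContraFunctor C A) (S : ContraFunctor A C)
       : Set (o ⊔ ℓ ⊔ e ⊔ o′ ⊔ ℓ′ ⊔ e′) where
  private
    module C = Category C
    module A = Category A
    module P = ContraFunctor P
    module S = ContraFunctor S
  field
    Φ : ∀ {X a} → X C.⇒ S.F₀ a → a A.⇒ P.F₀ X
    Ψ : ∀ {X a} → a A.⇒ P.F₀ X → X C.⇒ S.F₀ a
    Φ-resp-≈ : ∀ {X a} {h h′ : X C.⇒ S.F₀ a} → h C.≈ h′ → Φ h A.≈ Φ h′
    Ψ-resp-≈ : ∀ {X a} {k k′ : a A.⇒ P.F₀ X} → k A.≈ k′ → Ψ k C.≈ Ψ k′
    ΨΦ : ∀ {X a} (h : X C.⇒ S.F₀ a) → Ψ (Φ h) C.≈ h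
    ΦΨ : ∀ {X a} (k : a A.⇒ P.F₀ X) → Φ (Ψ k) A.≈ k
    natural : ∀ {X X′ a a′} (f : X′ C.⇒ X) (g : a′ A.⇒ a) (h : X C.⇒ S.F₀ a) →
              Φ (S.F₁ g C.∘ (h C.∘ f)) A.≈ P.F₁ f A.∘ (Φ h A.∘ g)

  η : ∀ X → X C.⇒ S.F₀ (P.F₀ X)
  η X = Ψ (A.id {P.F₀ X})

record Logic {o ℓ e o′ ℓ′ e′ : Level}
       {C : Category o ℓ e} {A : Category o′ ℓ′ e′}
       (P : ContraFunctor C A) (T : Functor C C)
       : Set (o ⊔ ℓ ⊔ e ⊔ o′ ⊔ ℓ′ ⊔ e′) where
  private
    module C = Category C
    module A = Category A
    module P = ContraFunctor P
    module T = Functor T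
  field
    L : Functor A A
  private module L = Functor L
  field
    ρ : ∀ X → L.F₀ (P.F₀ X) A.⇒ P.F₀ (T.F₀ X)
    ρ-natural : ∀ {X Y} (f : X C.⇒ Y) →
                ρ X A.∘ L.F₁ (P.F₁ f) A.≈ P.F₁ (T.F₁ f) A.∘ ρ Y

record Coalgebra {o ℓ e : Level} {C : Category o ℓ e} (T : Functor C C) : Set (o ⊔ ℓ) where
  private module C = Category C
  field
    X : C.Obj
    γ : X C.⇒ Functor.F₀ T X

-- pbC    : chosen pullbacks in C (C is finitely complete)
-- dualPB : a chosen pullback in A of  P X₁ → P B ← P X₂  for every
--          jointly mono span (exists since A has pullbacks, or since C has
--          pushouts and P turns pushouts into pullbacks)

module _ {o ℓ e o′ ℓ′ e′ : Level}
         {C : Category o ℓ e} {A : Category o′ ℓ′ e′}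
         {P : ContraFunctor C A} {S : ContraFunctor A C}
         (adj : DualAdjunction P S)
         {T : Functor C C} (lg : Logic P T)
         (pbC : HasPullbacks C)
         (dualPB : ∀ {X₁ X₂} (R : Rel C X₁ X₂) →
                   Pullback A (ContraFunctor.F₁ P (Span.π₁ (proj₁ R)))
                              (ContraFunctor.F₁ P (Span.π₂ (proj₁ R))))
         where
  private
    module C = Category C
    module A = Category A
    module P = ContraFunctor P
    module S = ContraFunctor S
    module T = Functor T
    module Lg = Logic lg
    module L = Functor Lg.L
    open DualAdjunction adj using (η)

  σ : ∀ {X₁ X₂} (R : Rel C X₁ X₂) (X : C.Obj) →
      Pullback.P (dualPB R) A.⇒ P.F₀ X → T.F₀ X C.⇒ S.F₀ (L.F₀ (Pullback.P (dualPB R)))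
  σ R X π̄ = S.F₁ (L.F₁ π̄) C.∘ (S.F₁ (Lg.ρ X) C.∘ η (T.F₀ X))

  Tρ : (c₁ c₂ : Coalgebra T) →
       Rel C (Coalgebra.X c₁) (Coalgebra.X c₂) → Rel C (Coalgebra.X c₁) (Coalgebra.X c₂)
  Tρ c₁ c₂ R =
    pullbackRel C
      (pbC (σ R X₁ (Pullback.p₁ (dualPB R)) C.∘ Coalgebra.γ c₁)
           (σ R X₂ (Pullback.p₂ (dualPB R)) C.∘ Coalgebra.γ c₂))
    where
      X₁ = Coalgebra.X c₁
      X₂ = Coalgebra.X c₂

-- If R ≤ R′ via k : B → B′, then P k mediates between the dual spans, giving
-- u : B̄′ → B̄ over P X₁ and P X₂. Hence σ′ᵢ = S L u ∘ σᵢ, so the two maps whose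
-- pullback is T^ρ(R′) are those for T^ρ(R) postcomposed with S L u, and the
-- pullback square of T^ρ(R) is a cone over the cospan of T^ρ(R′).
module Submission where

open import Defs
open import Level using (Level)
open import Data.Product using (proj₁; proj₂; _,_)
open import Data.Sum using (_⊎_)
open import Relation.Binary.Bundles using (Setoid)
import Relation.Binary.Reasoning.Setoid as SetoidReasoning

module _ {o ℓ e : Level} (C : Category o ℓ e) where
  open Category C

  hom-setoid : Obj → Obj → Setoid ℓ e
  hom-setoid X Y = record { Carrier = X ⇒ Y ; _≈_ = _≈_ ; isEquivalence = equiv }

  factor-∘ : ∀ {W X Z Z′} {f : X ⇒ Z} {f′ : X ⇒ Z′} {h : Z ⇒ Z′} {g : W ⇒ X} →
             f′ ≈ h ∘ f → f′ ∘ g ≈ h ∘ (f ∘ g)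
  factor-∘ f′≈h∘f = Eq.trans (∘-resp-≈ f′≈h∘f Eq.refl) assoc

  pullbackRel-≤-postcompose :
    ∀ {X Y Z Z′} {f : X ⇒ Z} {g : Y ⇒ Z} {f′ : X ⇒ Z′} {g′ : Y ⇒ Z′} {h : Z ⇒ Z′}
    (pb : Pullback C f g) (pb′ : Pullback C f′ g′) →
    f′ ≈ h ∘ f → g′ ≈ h ∘ g → _≤Rel_ C (pullbackRel C pb) (pullbackRel C pb′)
  pullbackRel-≤-postcompose {f = f} {g} {f′} {g′} {h} pb pb′ f′≈h∘f g′≈h∘g =
    universal Q.p₁ Q.p₂ cone , Eq.sym (universal₁ cone) , Eq.sym (universal₂ cone)
    where
      module Q = Pullback pb
      open Pullback pb′ using (universal; universal₁; universal₂)
      open SetoidReasoning (hom-setoid _ _)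

      cone : f′ ∘ Q.p₁ ≈ g′ ∘ Q.p₂
      cone = begin
        f′ ∘ Q.p₁      ≈⟨ factor-∘ f′≈h∘f ⟩
        h ∘ (f ∘ Q.p₁) ≈⟨ ∘-resp-≈ Eq.refl Q.commute ⟩
        h ∘ (g ∘ Q.p₂) ≈⟨ factor-∘ g′≈h∘g ⟨
        g′ ∘ Q.p₂      ∎

module _ {o ℓ e o′ ℓ′ e′ : Level} {C : Category o ℓ e} {D : Category o′ ℓ′ e′} where
  private
    module C = Category C
    module D = Category D

  F₁-resp-∘ : (F : Functor C D) → let open Functor F in
              ∀ {X Y Z} {a : X C.⇒ Z} {b : Y C.⇒ Z} {k : X C.⇒ Y} →
              a C.≈ b C.∘ k → F₁ a D.≈ F₁ b D.∘ F₁ k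
  F₁-resp-∘ F a≈b∘k = D.Eq.trans (F-resp-≈ a≈b∘k) homomorphism
    where open Functor F

  contraF₁-resp-∘ : (F : ContraFunctor C D) → let open ContraFunctor F in
                    ∀ {X Y Z} {a : X C.⇒ Z} {b : Y C.⇒ Z} {k : X C.⇒ Y} →
                    a C.≈ b C.∘ k → F₁ a D.≈ F₁ k D.∘ F₁ b
  contraF₁-resp-∘ F a≈b∘k = D.Eq.trans (F-resp-≈ a≈b∘k) homomorphism
    where open ContraFunctor F

-- Well-poweredness, the factorisation system and the existence of the dual
-- pullbacks only serve to make T^ρ well defined; monotonicity needs none of them.
lemma3p20 : {o ℓ e o′ ℓ′ e′ : Level}
    (C : Category o ℓ e) (A : Category o′ ℓ′ e′)
    (fcC : FinitelyComplete C) (wpC : WellPowered C) (fsC : EMonoFactorisation C)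
    (pbA-or-poC : HasPullbacks A ⊎ HasPushouts C)
    (P : ContraFunctor C A) (S : ContraFunctor A C) (adj : DualAdjunction P S)
    (T : Functor C C) (lg : Logic P T)
    (dualPB : ∀ {X₁ X₂} (R : Rel C X₁ X₂) →
              Pullback A (ContraFunctor.F₁ P (Span.π₁ (proj₁ R)))
                         (ContraFunctor.F₁ P (Span.π₂ (proj₁ R))))
    (c₁ c₂ : Coalgebra T) (R R′ : Rel C (Coalgebra.X c₁) (Coalgebra.X c₂)) →
    _≤Rel_ C R R′ →
    _≤Rel_ C (Tρ adj lg (FinitelyComplete.pullback fcC) dualPB c₁ c₂ R)
             (Tρ adj lg (FinitelyComplete.pullback fcC) dualPB c₁ c₂ R′)
lemma3p20 C A fcC _ _ _ P S adj T lg dualPB c₁ c₂ R R′ (k , π₁≈π₁′∘k , π₂≈π₂′∘k) =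
  pullbackRel-≤-postcompose C (pbC _ _) (pbC _ _)
    (σ′∘γ-factor c₁ (proj₁ (proj₂ comparison)))
    (σ′∘γ-factor c₂ (proj₂ (proj₂ comparison)))
  where
    module C = Category C
    module A = Category A
    pbC = FinitelyComplete.pullback fcC

    comparison : _≤Rel_ A (pullbackRel A (dualPB R′)) (pullbackRel A (dualPB R))
    comparison = pullbackRel-≤-postcompose A (dualPB R′) (dualPB R)
                   (contraF₁-resp-∘ P π₁≈π₁′∘k) (contraF₁-resp-∘ P π₂≈π₂′∘k)

    open ContraFunctor S using () renaming (F₀ to S₀; F₁ to S₁)
    open Functor (Logic.L lg) using () renaming (F₀ to L₀; F₁ to L₁)

    u : Pullback.P (dualPB R′) A.⇒ Pullback.P (dualPB R)
    u = proj₁ comparison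

    SLu : S₀ (L₀ (Pullback.P (dualPB R))) C.⇒ S₀ (L₀ (Pullback.P (dualPB R′)))
    SLu = S₁ (L₁ u)

    σ′∘γ-factor : ∀ (c : Coalgebra T) {p p′} → p′ A.≈ p A.∘ u →
                  σ adj lg pbC dualPB R′ (Coalgebra.X c) p′ C.∘ Coalgebra.γ c
                    C.≈ SLu C.∘ (σ adj lg pbC dualPB R (Coalgebra.X c) p C.∘ Coalgebra.γ c)
    σ′∘γ-factor c p′≈p∘u =
      factor-∘ C (factor-∘ C (contraF₁-resp-∘ S (F₁-resp-∘ (Logic.L lg) p′≈p∘u)))
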